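{- Let $L$ be an Ex-lattice. Then the relation $\sim\subseteq L\times L$ defined by $a\sim b\iff\lnot a=\lnot b$ is a congruence relation of $(L,\wedge,\vee,\lnot)$.
   Context: A fundamental lattice is a bounded lattice $(L,\wedge,\vee,0,1)$ with unary $\lnot$ that is antitone, satisfies $a\wedge\lnot a=0$ and $a\le\lnot\lnot a$. An Ex-lattice is a fundamental lattice in which, for all $a,b,c,d,e,f$: $\lnot\big[a\wedge((b\wedge c)\vee(b\wedge d))\big]\wedge a\wedge(c\vee e)\wedge\lnot\lnot f \le \lnot\lnot(a\wedge f)\wedge\big[(a\wedge c)\vee(a\wedge e)\vee f\big]\wedge\big[(b\wedge(c\vee d))\vee\lnot(b\wedge(c\vee d))\big]$. A congruence is an equivalence relation compatible with the operations $\wedge,\vee,\lnot$. -}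

module Defs where

open import Level using (Level; _⊔_; suc)
open import Relation.Binary.Core using (Rel)
open import Relation.Binary.Structures using (IsEquivalence)
open import Relation.Binary.Lattice.Bundles using (BoundedLattice)
open import Algebra.Core using (Op₁)

record FundamentalLattice c ℓ₁ ℓ₂ : Set (suc (c ⊔ ℓ₁ ⊔ ℓ₂)) where
  field
    boundedLattice : BoundedLattice c ℓ₁ ℓ₂
  open BoundedLattice boundedLattice public
  field
    ¬_         : Op₁ Carrier
    ¬-cong     : ∀ {a b} → a ≈ b → (¬ a) ≈ (¬ b)
    ¬-antitone : ∀ {a b} → a ≤ b → (¬ b) ≤ (¬ a)
    ∧-¬        : ∀ a → (a ∧ (¬ a)) ≈ ⊥
    ≤-¬¬       : ∀ a → a ≤ (¬ (¬ a))

record ExLattice c ℓ₁ ℓ₂ : Set (suc (c ⊔ ℓ₁ ⊔ ℓ₂)) where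
  field
    fundamentalLattice : FundamentalLattice c ℓ₁ ℓ₂
  open FundamentalLattice fundamentalLattice public
  field
    Ex : ∀ a b c d e f →
         ((¬ (a ∧ ((b ∧ c) ∨ (b ∧ d)))) ∧ a ∧ (c ∨ e) ∧ (¬ (¬ f)))
         ≤ ((¬ (¬ (a ∧ f)))
             ∧ (((a ∧ c) ∨ (a ∧ e)) ∨ f)
             ∧ ((b ∧ (c ∨ d)) ∨ (¬ (b ∧ (c ∨ d)))))

record IsCongruence {c ℓ₁ ℓ₂ ℓ} (L : FundamentalLattice c ℓ₁ ℓ₂)
                    (_∼_ : Rel (FundamentalLattice.Carrier L) ℓ)
                    : Set (c ⊔ ℓ₁ ⊔ ℓ) where
  open FundamentalLattice L
  field
    isEquivalence : IsEquivalence _∼_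
    respects-≈    : ∀ {a b} → a ≈ b → a ∼ b
    ∧-compat      : ∀ {a b c d} → a ∼ b → c ∼ d → (a ∧ c) ∼ (b ∧ d)
    ∨-compat      : ∀ {a b c d} → a ∼ b → c ∼ d → (a ∨ c) ∼ (b ∨ d)
    ¬-compat      : ∀ {a b} → a ∼ b → (¬ a) ∼ (¬ b)

_∼¬_ : ∀ {c ℓ₁ ℓ₂} {L : FundamentalLattice c ℓ₁ ℓ₂} →
       Rel (FundamentalLattice.Carrier L) ℓ₁
_∼¬_ {L = L} a b = (¬ a) ≈ (¬ b)
  where open FundamentalLattice L

{-# OPTIONS --safe #-}
module Submission where

open import Defs
open import Algebra.Core using (Op₂)
open import Relation.Binary.Core using (Rel)
open import Relation.Binary.Structures using (IsEquivalence)
import Relation.Binary.Lattice.Properties.MeetSemilattice as MeetSemilatticeProperties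
import Relation.Binary.Reasoning.PartialOrder as PartialOrderReasoning

-- Since a ≤ ¬¬a and ¬ is antitone, ¬¬ is a closure operator with ¬¬¬ = ¬,
-- and a ∼¬ b says exactly that a and b have the same closure. In every
-- fundamental lattice the closures of a ∨ c and b ∨ d then agree, whereas for
-- ∧ one needs ¬¬a ∧ ¬¬c ≤ ¬¬(a ∧ c), which follows from x ∧ ¬¬y ≤ ¬¬(x ∧ y)
-- (this condition is also necessary, as y ∼¬ ¬¬y), and that inequality is the
-- instance a = x, b = ⊥, c = d = e = ⊤, f = y of (Ex).

module FundamentalLatticeProperties {c ℓ₁ ℓ₂} (L : FundamentalLattice c ℓ₁ ℓ₂) where

  open FundamentalLattice L
  open MeetSemilatticeProperties meetSemilattice using (∧-comm; ∧-monotonic)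
  open PartialOrderReasoning poset

  infix 4 _∼_
  _∼_ : Rel Carrier ℓ₁
  _∼_ = _∼¬_ {L = L}

  ¬¬-monotone : ∀ {a b} → a ≤ b → ¬ ¬ a ≤ ¬ ¬ b
  ¬¬-monotone a≤b = ¬-antitone (¬-antitone a≤b)

  ≤¬¬⇒¬-antitone : ∀ {a b} → a ≤ ¬ ¬ b → ¬ b ≤ ¬ a
  ≤¬¬⇒¬-antitone {a} {b} a≤¬¬b = begin
    ¬ b     ≤⟨ ≤-¬¬ (¬ b) ⟩
    ¬ ¬ ¬ b ≤⟨ ¬-antitone a≤¬¬b ⟩
    ¬ a     ∎

  ≤¬¬⇒¬¬≤¬¬ : ∀ {a b} → a ≤ ¬ ¬ b → ¬ ¬ a ≤ ¬ ¬ b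
  ≤¬¬⇒¬¬≤¬¬ a≤¬¬b = ¬-antitone (≤¬¬⇒¬-antitone a≤¬¬b)

  ⊤≤¬⊥ : ⊤ ≤ ¬ ⊥
  ⊤≤¬⊥ = begin
    ⊤     ≤⟨ ≤-¬¬ ⊤ ⟩
    ¬ ¬ ⊤ ≤⟨ ¬-antitone (minimum (¬ ⊤)) ⟩
    ¬ ⊥   ∎

  ∼⇒≤¬¬ : ∀ {a b} → a ∼ b → b ≤ ¬ ¬ a
  ∼⇒≤¬¬ {a} {b} ¬a≈¬b = begin
    b     ≤⟨ ≤-¬¬ b ⟩
    ¬ ¬ b ≈⟨ ¬-cong ¬a≈¬b ⟨
    ¬ ¬ a ∎

  ∼-isEquivalence : IsEquivalence _∼_
  ∼-isEquivalence = record { refl = Eq.refl ; sym = Eq.sym ; trans = Eq.trans }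

  ≤¬¬⇒∼ : ∀ {a b} → b ≤ ¬ ¬ a → a ≤ ¬ ¬ b → a ∼ b
  ≤¬¬⇒∼ b≤¬¬a a≤¬¬b = antisym (≤¬¬⇒¬-antitone b≤¬¬a) (≤¬¬⇒¬-antitone a≤¬¬b)

  ∼-compat₂ : (_∙_ : Op₂ Carrier) →
              (∀ {a b c d} → b ≤ ¬ ¬ a → d ≤ ¬ ¬ c → b ∙ d ≤ ¬ ¬ (a ∙ c)) →
              ∀ {a b c d} → a ∼ b → c ∼ d → (a ∙ c) ∼ (b ∙ d)
  ∼-compat₂ _∙_ ∙-≤¬¬ a∼b c∼d = ≤¬¬⇒∼
    (∙-≤¬¬ (∼⇒≤¬¬ a∼b) (∼⇒≤¬¬ c∼d))
    (∙-≤¬¬ (∼⇒≤¬¬ (Eq.sym a∼b)) (∼⇒≤¬¬ (Eq.sym c∼d)))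

  ∨-≤¬¬ : ∀ {a b c d} → b ≤ ¬ ¬ a → d ≤ ¬ ¬ c → b ∨ d ≤ ¬ ¬ (a ∨ c)
  ∨-≤¬¬ b≤¬¬a d≤¬¬c = ∨-least
    (trans b≤¬¬a (¬¬-monotone (x≤x∨y _ _)))
    (trans d≤¬¬c (¬¬-monotone (y≤x∨y _ _)))

  module _ (∧-¬¬-≤ : ∀ x y → x ∧ ¬ ¬ y ≤ ¬ ¬ (x ∧ y)) where

    ¬¬-∧-≤ : ∀ a c → ¬ ¬ a ∧ ¬ ¬ c ≤ ¬ ¬ (a ∧ c)
    ¬¬-∧-≤ a c = begin
      ¬ ¬ a ∧ ¬ ¬ c       ≤⟨ ∧-¬¬-≤ (¬ ¬ a) c ⟩
      ¬ ¬ (¬ ¬ a ∧ c)     ≤⟨ ≤¬¬⇒¬¬≤¬¬ ¬¬a∧c≤¬¬[a∧c] ⟩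
      ¬ ¬ (a ∧ c)         ∎
      where
      ¬¬a∧c≤¬¬[a∧c] : ¬ ¬ a ∧ c ≤ ¬ ¬ (a ∧ c)
      ¬¬a∧c≤¬¬[a∧c] = begin
        ¬ ¬ a ∧ c     ≈⟨ ∧-comm (¬ ¬ a) c ⟩
        c ∧ ¬ ¬ a     ≤⟨ ∧-¬¬-≤ c a ⟩
        ¬ ¬ (c ∧ a)   ≈⟨ ¬-cong (¬-cong (∧-comm c a)) ⟩
        ¬ ¬ (a ∧ c)   ∎

    ∧-≤¬¬ : ∀ {a b c d} → b ≤ ¬ ¬ a → d ≤ ¬ ¬ c → b ∧ d ≤ ¬ ¬ (a ∧ c)
    ∧-≤¬¬ {a} {b} {c} {d} b≤¬¬a d≤¬¬c = begin
      b ∧ d           ≤⟨ ∧-monotonic b≤¬¬a d≤¬¬c ⟩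
      ¬ ¬ a ∧ ¬ ¬ c   ≤⟨ ¬¬-∧-≤ a c ⟩
      ¬ ¬ (a ∧ c)     ∎

    ∼-isCongruence : IsCongruence L _∼_
    ∼-isCongruence = record
      { isEquivalence = ∼-isEquivalence
      ; respects-≈    = ¬-cong
      ; ∧-compat      = ∼-compat₂ _∧_ ∧-≤¬¬
      ; ∨-compat      = ∼-compat₂ _∨_ ∨-≤¬¬
      ; ¬-compat      = ¬-cong
      }

module ExLatticeProperties {c ℓ₁ ℓ₂} (L : ExLattice c ℓ₁ ℓ₂) where

  open ExLattice L
  open FundamentalLatticeProperties fundamentalLattice using (⊤≤¬⊥)
  open PartialOrderReasoning poset

  ∧-¬¬-≤ : ∀ x y → x ∧ ¬ ¬ y ≤ ¬ ¬ (x ∧ y)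
  ∧-¬¬-≤ x y = begin
    x ∧ ¬ ¬ y
      ≤⟨ ∧-greatest ≤¬[x∧⊥] (∧-greatest (x∧y≤x _ _) (∧-greatest (≤⊤∨⊤ _) (x∧y≤y _ _))) ⟩
    ¬ (x ∧ ((⊥ ∧ ⊤) ∨ (⊥ ∧ ⊤))) ∧ x ∧ (⊤ ∨ ⊤) ∧ ¬ ¬ y
      ≤⟨ Ex x ⊥ ⊤ ⊤ ⊤ y ⟩
    ¬ ¬ (x ∧ y) ∧ _
      ≤⟨ x∧y≤x _ _ ⟩
    ¬ ¬ (x ∧ y) ∎
    where
    ≤⊤∨⊤ : ∀ z → z ≤ ⊤ ∨ ⊤
    ≤⊤∨⊤ z = trans (maximum z) (x≤x∨y ⊤ ⊤)

    x∧⊥≤⊥ : x ∧ ((⊥ ∧ ⊤) ∨ (⊥ ∧ ⊤)) ≤ ⊥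
    x∧⊥≤⊥ = trans (x∧y≤y _ _) (∨-least (x∧y≤x ⊥ ⊤) (x∧y≤x ⊥ ⊤))

    ≤¬[x∧⊥] : x ∧ ¬ ¬ y ≤ ¬ (x ∧ ((⊥ ∧ ⊤) ∨ (⊥ ∧ ⊤)))
    ≤¬[x∧⊥] = trans (maximum _) (trans ⊤≤¬⊥ (¬-antitone x∧⊥≤⊥))

lemma4p2 : ∀ {c ℓ₁ ℓ₂} (L : ExLattice c ℓ₁ ℓ₂) →
    IsCongruence (ExLattice.fundamentalLattice L)
    (_∼¬_ {L = ExLattice.fundamentalLattice L})
lemma4p2 L = ∼-isCongruence fundamentalLattice ∧-¬¬-≤
  where
  open ExLattice L using (fundamentalLattice)
  open FundamentalLatticeProperties using (∼-isCongruence)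
  open ExLatticeProperties L using (∧-¬¬-≤)
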